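{- Let $V$ be a finite set with a linear order $<_V$, and let $E\subseteq V^2$ be a binary relation such that the matrix $\mathrm{Adj}(E,<_V)$ contains no $k$-grid. Let $<_{\mathrm{lex}}$ be the lexicographic order on $E$: $(x,y)<_{\mathrm{lex}}(x',y')$ iff $x<_Vx'$, or $x=x'$ and $y<_Vy'$. Then the matrix $\mathrm{Inc}(E,<_V,<_{\mathrm{lex}})$ contains no $4k$-grid.
   Context: $\mathrm{Adj}(E,<_V)$ is the $0$–$1$ matrix with rows and columns indexed by $V$ in the order $<_V$, whose entry at $(x,y)$ is $1$ iff $(x,y)\in E$. $\mathrm{Inc}(E,<_V,<_{\mathrm{lex}})$ is the $0$–$1$ matrix with rows indexed by $V$ ordered by $<_V$ and columns indexed by $E$ ordered by $<_{\mathrm{lex}}$, whose entry at $(v,e)$ is $1$ iff $v$ is the source $x$ or the target $y$ of $e=(x,y)$. Grids: for $n\in\mathbb{N}$, $[n]=\{1,\dots,n\}$. A $t$-grid in a point set of $\mathbb{R}^2$ is a family $(p_{i,j})_{i,j\in[t]}$ such that for all $i,i',j,j'$: $i<i'$ implies $\pi_x(p_{i,j})<\pi_x(p_{i',j'})$, and $j<j'$ implies $\pi_y(p_{i,j})<\pi_y(p_{i',j'})$, where $\pi_x,\pi_y$ are the coordinates. A $0$–$1$ matrix contains a $t$-grid if the set of points $(i,j)$ such that the entry in row position $i$ and column position $j$ is $1$ contains a $t$-grid. -}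

module Defs where

open import Data.Nat using (ℕ)
open import Data.Fin using (Fin) renaming (_<_ to _<ᶠ_)
open import Data.Bool using (Bool; true)
open import Data.Product using (Σ; _×_; _,_; proj₁; proj₂)
open import Data.Sum using (_⊎_)
open import Relation.Binary.PropositionalEquality using (_≡_)

-- A 0-1 matrix with rows indexed by a strictly ordered set R and columns by a
-- strictly ordered set C; M r c holds iff the entry at (r , c) is 1.
-- It contains a t-grid if there are points p(i,j) (i,j ∈ [t]) with entry 1 such
-- that i < i' forces row(p i j) < row(p i' j') and j < j' forces
-- col(p i j) < col(p i' j').
ContainsGrid : {R C : Set} → (R → R → Set) → (C → C → Set) →
               (R → C → Set) → ℕ → Set
ContainsGrid {R} {C} _<R_ _<C_ M t =
  Σ (Fin t → Fin t → R × C) λ p →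
    (∀ i j → M (proj₁ (p i j)) (proj₂ (p i j))) ×
    (∀ i i' j j' → i <ᶠ i' → proj₁ (p i j) <R proj₁ (p i' j')) ×
    (∀ i i' j j' → j <ᶠ j' → proj₂ (p i j) <C proj₂ (p i' j'))

Rel : ℕ → Set
Rel n = Fin n → Fin n → Bool

Adj : {n : ℕ} → Rel n → Fin n → Fin n → Set
Adj E x y = E x y ≡ true

Edge : {n : ℕ} → Rel n → Set
Edge {n} E = Σ (Fin n × Fin n) λ e → E (proj₁ e) (proj₂ e) ≡ true

_<lex_ : {n : ℕ} {E : Rel n} → Edge E → Edge E → Set
((x , y) , _) <lex ((x' , y') , _) = x <ᶠ x' ⊎ (x ≡ x' × y <ᶠ y')

Inc : {n : ℕ} (E : Rel n) → Fin n → Edge E → Set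
Inc E v ((x , y) , _) = v ≡ x ⊎ v ≡ y

-- Cut a 4k-grid of Inc(E) into k × k blocks of 4 × 4 points; each point is an
-- occurrence of its row vertex in its column edge (x , y), as source or as
-- target. The top-left 2 × 2 corner of every block contains a target
-- occurrence, since two source occurrences on its anti-diagonal would be
-- ordered oppositely by the rows and by the lexicographic columns. The edges at
-- these occurrences form a k-grid of Adj(E). Their targets are the row
-- vertices, so they increase with the block row. Their sources increase
-- strictly with the block column: otherwise the two spare columns of a block
-- share one source, and target occurrences taken from rows 3–4 of the first
-- and rows 1–2 of the second column are ordered oppositely by the rows and by
-- the lexicographic columns.
module Submission where

open import Defs
open import Data.Nat using (ℕ; _*_; _+_; z<s; s<s) renaming (_<_ to _<ℕ_)
import Data.Nat.Properties as ℕ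
open import Data.Fin using (Fin; toℕ; combine; cast) renaming (_<_ to _<ᶠ_; _≤_ to _≤ᶠ_)
open import Data.Fin.Patterns using (0F; 1F; 2F; 3F)
open import Data.Fin.Properties
  using (≤-reflexive; ≤-antisym; <-irrefl; <-asym; toℕ-cast; combine-monoˡ-<; toℕ-combine)
open import Data.Product using (Σ-syntax; _×_; _,_; proj₁; proj₂)
open import Data.Sum using (_⊎_; inj₁; inj₂)
open import Data.Empty using (⊥; ⊥-elim)
open import Relation.Nullary using (¬_)
open import Function using (_∘_)
open import Relation.Binary.PropositionalEquality using (_≡_; sym; trans; subst₂)

module IncidenceGrid {n t : ℕ} {E : Rel n}
  (p : Fin t → Fin t → Fin n × Edge E)
  (incident : ∀ i j → Inc E (proj₁ (p i j)) (proj₂ (p i j)))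
  (rows-< : ∀ i i' j j' → i <ᶠ i' → proj₁ (p i j) <ᶠ proj₁ (p i' j'))
  (cols-< : ∀ i i' j j' → j <ᶠ j' → _<lex_ {n} {E} (proj₂ (p i j)) (proj₂ (p i' j')))
  where

  vertex source target : Fin t → Fin t → Fin n
  vertex i j = proj₁ (p i j)
  source i j = proj₁ (proj₁ (proj₂ (p i j)))
  target i j = proj₂ (proj₁ (proj₂ (p i j)))

  IsTarget : Fin t → Fin t → Set
  IsTarget i j = vertex i j ≡ target i j

  source-mono : ∀ {i i' j j'} → j <ᶠ j' → source i j ≤ᶠ source i' j'
  source-mono {i} {i'} {j} {j'} j<j' with cols-< i i' j j' j<j'
  ... | inj₁ x<x'       = ℕ.<⇒≤ x<x'
  ... | inj₂ (x≡x' , _) = ≤-reflexive x≡x'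

  target-mono-on-common-source : ∀ {i i' j j'} → j <ᶠ j' →
    source i j ≡ source i' j' → target i j <ᶠ target i' j'
  target-mono-on-common-source {i} {i'} {j} {j'} j<j' x≡x' with cols-< i i' j j' j<j'
  ... | inj₁ x<x'       = ⊥-elim (<-irrefl x≡x' x<x')
  ... | inj₂ (_ , y<y') = y<y'

  source-or-target : ∀ i j → vertex i j ≡ source i j ⊎ IsTarget i j
  source-or-target = incident

  record TargetIn (r r' c c' : Fin t) : Set where
    field
      row col   : Fin t
      row-lower : r ≤ᶠ row
      row-upper : row ≤ᶠ r'
      col-lower : c ≤ᶠ col
      col-upper : col ≤ᶠ c'
      is-target : IsTarget row col

  target-in-rectangle : ∀ {r r' c c'} → r <ᶠ r' → c <ᶠ c' → TargetIn r r' c c'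
  target-in-rectangle {r} {r'} {c} {c'} r<r' c<c'
    with source-or-target r' c | source-or-target r c'
  ... | inj₂ tgt | _       = record { row = r' ; col = c ; is-target = tgt
    ; row-lower = ℕ.<⇒≤ r<r' ; row-upper = ℕ.≤-refl ; col-lower = ℕ.≤-refl ; col-upper = ℕ.<⇒≤ c<c' }
  ... | inj₁ _   | inj₂ tgt = record { row = r ; col = c' ; is-target = tgt
    ; row-lower = ℕ.≤-refl ; row-upper = ℕ.<⇒≤ r<r' ; col-lower = ℕ.<⇒≤ c<c' ; col-upper = ℕ.≤-refl }
  ... | inj₁ src | inj₁ src' =
    ⊥-elim (ℕ.<⇒≱ (rows-< r r' c' c r<r') (subst₂ _≤ᶠ_ (sym src) (sym src') (source-mono c<c')))

  target-in-column : ∀ {r r' c} → r <ᶠ r' → source r c ≡ source r' c →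
    Σ[ i ∈ Fin t ] r ≤ᶠ i × i ≤ᶠ r' × IsTarget i c
  target-in-column {r} {r'} {c} r<r' x≡x' with source-or-target r c | source-or-target r' c
  ... | inj₂ tgt | _        = r  , ℕ.≤-refl , ℕ.<⇒≤ r<r' , tgt
  ... | inj₁ _   | inj₂ tgt = r' , ℕ.<⇒≤ r<r' , ℕ.≤-refl , tgt
  ... | inj₁ src | inj₁ src' =
    ⊥-elim (<-irrefl (trans src (trans x≡x' (sym src'))) (rows-< r r' c c r<r'))

  ¬common-source-on-two-columns : ∀ {s c c' r₀ r₁ r₂ r₃} → c <ᶠ c' →
    r₀ <ᶠ r₁ → r₁ <ᶠ r₂ → r₂ <ᶠ r₃ →
    (∀ r → source r c ≡ s) → (∀ r → source r c' ≡ s) → ⊥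
  ¬common-source-on-two-columns {c = c} {c'} {r₀} {r₁} {r₂} {r₃} c<c' r₀<r₁ r₁<r₂ r₂<r₃ src src'
    with target-in-column {c = c} r₂<r₃ (trans (src r₂) (sym (src r₃)))
       | target-in-column {c = c'} r₀<r₁ (trans (src' r₀) (sym (src' r₁)))
  ... | r , r₂≤r , _ , tgt | r' , _ , r'≤r₁ , tgt' =
    <-asym (rows-< r' r c' c r'<r)
           (subst₂ _<ᶠ_ (sym tgt) (sym tgt')
                   (target-mono-on-common-source c<c' (trans (src r) (sym (src' r')))))
    where
      r'<r : r' <ᶠ r
      r'<r = ℕ.≤-<-trans r'≤r₁ (ℕ.<-≤-trans r₁<r₂ r₂≤r)

  source-strict : ∀ {i i' j c c' j' r₀ r₁ r₂ r₃} → j <ᶠ c → c <ᶠ c' → c' <ᶠ j' →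
    r₀ <ᶠ r₁ → r₁ <ᶠ r₂ → r₂ <ᶠ r₃ → source i j <ᶠ source i' j'
  source-strict {i} {i'} {j} {j' = j'} j<c c<c' c'<j' r₀<r₁ r₁<r₂ r₂<r₃
    with ℕ.m≤n⇒m<n∨m≡n (source-mono {i} {i'} (ℕ.<-trans j<c (ℕ.<-trans c<c' c'<j')))
  ... | inj₁ x<x' = x<x'
  ... | inj₂ x≡x' = ⊥-elim (¬common-source-on-two-columns c<c' r₀<r₁ r₁<r₂ r₂<r₃
                      (squeezed j<c (ℕ.<-trans c<c' c'<j')) (squeezed (ℕ.<-trans j<c c<c') c'<j'))
    where
      squeezed : ∀ {m} → j <ᶠ m → m <ᶠ j' → ∀ r → source r m ≡ source i j
      squeezed j<m m<j' r =
        ≤-antisym (ℕ.≤-trans (source-mono m<j') (ℕ.≤-reflexive (sym x≡x'))) (source-mono j<m)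

block : ∀ {k m} → Fin k → Fin m → Fin (m * k)
block {k} {m} a c = cast (ℕ.*-comm k m) (combine a c)

toℕ-block : ∀ {k m} (a : Fin k) (c : Fin m) → toℕ (block a c) ≡ m * toℕ a + toℕ c
toℕ-block a c = trans (toℕ-cast _ (combine a c)) (toℕ-combine a c)

block-monoˡ-< : ∀ {k m} {a a' : Fin k} (c c' : Fin m) → a <ᶠ a' → block a c <ᶠ block a' c'
block-monoˡ-< {a = a} {a'} c c' a<a' =
  subst₂ _<ℕ_ (sym (toℕ-cast _ (combine a c))) (sym (toℕ-cast _ (combine a' c')))
         (combine-monoˡ-< c c' a<a')

block-monoʳ-< : ∀ {k m} (a : Fin k) (c c' : Fin m) → c <ᶠ c' → block a c <ᶠ block a c'
block-monoʳ-< {m = m} a c c' c<c' =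
  subst₂ _<ℕ_ (sym (toℕ-block a c)) (sym (toℕ-block a c')) (ℕ.+-monoʳ-< (m * toℕ a) c<c')

adjacency-grid : ∀ {n k} {E : Rel n} →
  ContainsGrid _<ᶠ_ (_<lex_ {n} {E}) (Inc E) (4 * k) → ContainsGrid _<ᶠ_ _<ᶠ_ (Adj E) k
adjacency-grid {n} {k} {E} (p , incident , rows-< , cols-<) =
  (λ a b → proj₁ (edge a b)) , (λ a b → proj₂ (edge a b)) , sources-< , targets-<
  where
    open IncidenceGrid p incident rows-< cols-<
    open TargetIn

    cell : Fin k → Fin 4 → Fin (4 * k)
    cell = block

    within : ∀ (a : Fin k) (c c' : Fin 4) → c <ᶠ c' → cell a c <ᶠ cell a c'
    within = block-monoʳ-<

    across : ∀ {a a' : Fin k} (c c' : Fin 4) → a <ᶠ a' → cell a c <ᶠ cell a' c'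
    across = block-monoˡ-<

    corner : (a b : Fin k) → TargetIn (cell b 0F) (cell b 1F) (cell a 0F) (cell a 1F)
    corner a b = target-in-rectangle (within b 0F 1F z<s) (within a 0F 1F z<s)

    edge : Fin k → Fin k → Edge E
    edge a b = proj₂ (p (row (corner a b)) (col (corner a b)))

    sources-< : ∀ a a' b b' → a <ᶠ a' →
      source (row (corner a b)) (col (corner a b)) <ᶠ source (row (corner a' b')) (col (corner a' b'))
    sources-< a a' b b' a<a' = source-strict
      (ℕ.≤-<-trans (col-upper (corner a b)) (within a 1F 2F (s<s z<s)))
      (within a 2F 3F (s<s (s<s z<s)))
      (ℕ.<-≤-trans (across 3F 0F a<a') (col-lower (corner a' b')))
      (within b 0F 1F z<s) (within b 1F 2F (s<s z<s)) (within b 2F 3F (s<s (s<s z<s)))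

    targets-< : ∀ a a' b b' → b <ᶠ b' →
      target (row (corner a b)) (col (corner a b)) <ᶠ target (row (corner a' b')) (col (corner a' b'))
    targets-< a a' b b' b<b' = subst₂ _<ᶠ_ (is-target (corner a b)) (is-target (corner a' b'))
      (rows-< _ _ _ _ (ℕ.≤-<-trans (row-upper (corner a b))
                         (ℕ.<-≤-trans (across 1F 0F b<b') (row-lower (corner a' b')))))

lemma8 : (n k : ℕ) (E : Rel n) →
    ¬ ContainsGrid _<ᶠ_ _<ᶠ_ (Adj E) k →
    ¬ ContainsGrid _<ᶠ_ (_<lex_ {n} {E}) (Inc E) (4 * k)
lemma8 n k E no-adjacency-grid = no-adjacency-grid ∘ adjacency-grid
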